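{- Let $n\ge 1$. The function $\eta^{\bigstar}_n$, defined on finite subsets of $\mathbf{RP}^n$, is supermodular: for every finite subset $\mathcal H\subset\mathbf{RP}^n$ and any two distinct points $\langle u\rangle,\langle v\rangle\in\mathbf{RP}^n\setminus\mathcal H$, $$\eta^{\bigstar}_n(\mathcal H\cup\{\langle u\rangle\})-\eta^{\bigstar}_n(\mathcal H)\ \le\ \eta^{\bigstar}_n(\mathcal H\cup\{\langle u\rangle,\langle v\rangle\})-\eta^{\bigstar}_n(\mathcal H\cup\{\langle v\rangle\}).$$
   Context: For a real vector space $V$ of dimension $m+1$ let $\mathbf P(V)$ be the set of its $1$-dimensional subspaces (so $\mathbf P(\mathbf R^{m+1})=\mathbf{RP}^m$); for $v\ne0$ write $\langle v\rangle$ for the line it spans. Let $\mathcal H=\{\langle w_1\rangle,\dots,\langle w_T\rangle\}\subset\mathbf P(V)$ be a finite set of $T$ distinct points, and let an order on $\mathcal H$ be a bijection $\pi:[T]\to\mathcal H$, $\pi(i)=\langle w_i\rangle$. An ordered $m$-tuple $(\langle w_{i_1}\rangle,\dots,\langle w_{i_m}\rangle)$ of distinct elements of $\mathcal H$ satisfies the $\eta^\pi_m(\mathcal H)$ condition if (1) $2\le i_1<i_2<\dots<i_m\le T$, and (2) for every $l=1,\dots,m$, $\langle w_{i_l}\rangle$ is the $\pi$-minimal element among all points of $\mathcal H$ contained in $\mathrm{span}(w_{i_l},\dots,w_{i_m})$. Let $B^\pi(\mathcal H)$ be the set of such tuples with $w_{i_1},\dots,w_{i_m}$ linearly independent. It is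 a known fact that $|B^\pi(\mathcal H)|$ does not depend on the order $\pi$ (it equals the rank of the homology group $H_{m-1}(K^{\mathcal H};\mathbb F)$ of the complex whose simplices are the subsets of $\mathcal H$ spanning a proper subspace of $\mathrm{span}\,\mathcal H$); this common value is denoted $\eta^{\bigstar}_m(\mathcal H)$. -}

module Defs where

open import Level using (0ℓ)
open import Data.Nat as ℕ using (ℕ; zero; suc)
open import Data.Fin as Fin using (Fin; toℕ)
open import Data.Vec using (Vec; []; _∷_; lookup; zipWith; map; replicate)
open import Data.List using (List; length)
open import Data.List.Membership.Propositional using (_∈_)
open import Data.List.Relation.Unary.Unique.Propositional using (Unique)
open import Data.Product using (Σ; ∃; _×_; _,_)
open import Data.Sum using (_⊎_)
open import Relation.Nullary using (¬_)
open import Relation.Binary.PropositionalEquality using (_≡_)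

-- The real numbers, axiomatised as a Dedekind-complete ordered field
-- (with propositional equality).  Any model of this record is (classically)
-- the field ℝ.

record RealField : Set₁ where
  infixl 6 _+_
  infixl 7 _*_
  infix 4 _<_ _≤_
  field
    Carrier : Set
    0# 1#   : Carrier
    _+_ _*_ : Carrier → Carrier → Carrier
    -_      : Carrier → Carrier
    _<_     : Carrier → Carrier → Set
    +-assoc     : ∀ x y z → (x + y) + z ≡ x + (y + z)
    +-comm      : ∀ x y → x + y ≡ y + x
    +-identityˡ : ∀ x → 0# + x ≡ x
    -‿inverseˡ  : ∀ x → (- x) + x ≡ 0#
    *-assoc     : ∀ x y z → (x * y) * z ≡ x * (y * z)
    *-comm      : ∀ x y → x * y ≡ y * x
    *-identityˡ : ∀ x → 1# * x ≡ x
    distribˡ    : ∀ x y z → x * (y + z) ≡ x * y + x * z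
    0≢1         : ¬ (0# ≡ 1#)
    inverse     : ∀ x → ¬ (x ≡ 0#) → ∃ λ y → x * y ≡ 1#
    <-irrefl    : ∀ x → ¬ (x < x)
    <-trans     : ∀ x y z → x < y → y < z → x < z
    <-trichotomy : ∀ x y → x < y ⊎ (x ≡ y ⊎ y < x)
    +-mono-<    : ∀ x y z → x < y → x + z < y + z
    *-pos       : ∀ x y → 0# < x → 0# < y → 0# < x * y

  _≤_ : Carrier → Carrier → Set
  x ≤ y = x < y ⊎ x ≡ y

  field
    completeness : (P : Carrier → Set) → (∃ λ x → P x) →
                   (∃ λ b → ∀ x → P x → x ≤ b) →
                   ∃ λ s → (∀ x → P x → x ≤ s) × (∀ b → (∀ x → P x → x ≤ b) → s ≤ b)

module _ (ℝ : RealField) where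
  open RealField ℝ

  zeroᵥ : ∀ {d} → Vec Carrier d
  zeroᵥ = replicate _ 0#

  _+ᵥ_ : ∀ {d} → Vec Carrier d → Vec Carrier d → Vec Carrier d
  _+ᵥ_ = zipWith _+_

  _•_ : ∀ {d} → Carrier → Vec Carrier d → Vec Carrier d
  c • x = map (c *_) x

  lincomb : ∀ {m d} → (Fin m → Carrier) → (Fin m → Vec Carrier d) → Vec Carrier d
  lincomb {zero}  c f = zeroᵥ
  lincomb {suc m} c f = (c Fin.zero • f Fin.zero) +ᵥ lincomb (λ a → c (Fin.suc a)) (λ a → f (Fin.suc a))

  LinIndep : ∀ {m d} → (Fin m → Vec Carrier d) → Set
  LinIndep f = ∀ c → lincomb c f ≡ zeroᵥ → ∀ a → c a ≡ 0#

  NonZeroV : ∀ {d} → Vec Carrier d → Set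
  NonZeroV x = ¬ (x ≡ zeroᵥ)

  -- ⟨x⟩ = ⟨y⟩ for nonzero x, y
  SameLine : ∀ {d} → Vec Carrier d → Vec Carrier d → Set
  SameLine x y = ∃ λ c → x ≡ c • y

  -- a list of nonzero vectors representing T distinct points of P(ℝ^d)
  DistinctPoints : ∀ {d T} → Vec (Vec Carrier d) T → Set
  DistinctPoints ws = (∀ i → NonZeroV (lookup ws i)) ×
                      (∀ i j → ¬ (i ≡ j) → ¬ SameLine (lookup ws i) (lookup ws j))

  NotInPoints : ∀ {d T} → Vec Carrier d → Vec (Vec Carrier d) T → Set
  NotInPoints x ws = ∀ i → ¬ SameLine x (lookup ws i)

  -- For a tuple t = (i_1,…,i_n) of indices (0-based) into ws, and a position l,
  -- x ∈ span(w_{i_l}, …, w_{i_n}).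
  InSpanFrom : ∀ {n d T} → Vec (Vec Carrier d) T → Vec (Fin T) n → Fin n →
               Vec Carrier d → Set
  InSpanFrom ws t l x =
    ∃ λ c → (∀ a → a Fin.< l → c a ≡ 0#) ×
            x ≡ lincomb c (λ a → lookup ws (lookup t a))

  -- The order π is the list order: π(i) = ⟨lookup ws i⟩.  The tuple t lists
  -- the (0-based) indices i_1 < … < i_n.  Membership in B^π(H):
  InB : ∀ {n T} → Vec (Vec Carrier (suc n)) T → Vec (Fin T) n → Set
  InB {n} {T} ws t =
    -- (1) 2 ≤ i_1 (1-based), i.e. no index is the first one
    (∀ a → 1 ℕ.≤ toℕ (lookup t a)) ×
    (∀ a b → a Fin.< b → lookup t a Fin.< lookup t b) ×
    (∀ l j → InSpanFrom ws t l (lookup ws j) → lookup t l Fin.≤ j) ×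
    LinIndep (λ a → lookup ws (lookup t a))

  -- η★_n(H) = k, where H = {⟨w_1⟩,…,⟨w_T⟩} ⊂ P(ℝ^{n+1}):
  -- B^π(H) is finite with exactly k elements.
  IsEtaStar : ∀ (n : ℕ) {T} → Vec (Vec Carrier (suc n)) T → ℕ → Set
  IsEtaStar n {T} ws k =
    Σ (List (Vec (Fin T) n)) λ L →
      Unique L × (∀ t → (t ∈ L → InB ws t) × (InB ws t → t ∈ L)) × length L ≡ k

-- Order H ∪ {u, v} with the points of H first, then u, then v, and write B, Bᵘ, Bᵛ, B²
-- for the sets B^π of good tuples of H, H ∪ {u}, H ∪ {v}, H ∪ {u, v}.  The minimality
-- of w_{i_l} can only fail because of a point earlier than w_{i_l}, so appending points
-- at the end of the order keeps good tuples good, and a good tuple avoiding the appended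
-- points was already good.  Hence Bᵛ ⊆ B ∪ X, where X ⊆ Bᵛ consists of the tuples using
-- v.  Inserting u just before v also keeps every tuple of X good: its tail starting at v
-- spans only ⟨v⟩ ∌ u.  So Bᵘ and X are disjoint subsets of B², giving
-- |Bᵛ| ≤ |B| + |X| and |Bᵘ| + |X| ≤ |B²|.

module Submission where

open import Defs
open import Data.Nat using (ℕ; suc; _+_; _≤_)
open import Data.Vec using (Vec; _∷_; []; _++_)
open import Relation.Nullary using (¬_)

open import Data.Nat using (zero; z≤n; s≤s; _<_)
import Data.Nat.Properties as ℕₚ
open import Algebra.Properties.CommutativeSemigroup ℕₚ.+-commutativeSemigroup using (x∙yz≈y∙xz)
open import Data.Fin as Fin using (Fin; toℕ; _↑ˡ_; _↑ʳ_; fromℕ)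
import Data.Fin.Properties as Finₚ
open import Data.Vec using (lookup; map)
open import Data.Vec.Properties using (lookup-map; lookup-++ˡ; lookup-++ʳ; ∷-injectiveˡ; ∷-injectiveʳ)
open import Data.Vec.Relation.Unary.Any using (here; there; satisfied)
import Data.Vec.Relation.Unary.Any.Properties as VecAnyₚ
open import Data.Vec.Membership.Propositional using () renaming (_∈_ to _∈ᵥ_)
open import Data.Vec.Membership.Propositional.Properties using () renaming (∈-map⁺ to ∈ᵥ-map⁺)
open import Data.List as List using (List; length; filter)
open import Data.List.Properties using (length-removeAt′; length-++; length-map)
open import Data.List.Relation.Unary.Any using (here; there; index; _─_)
import Data.List.Relation.Unary.All as All
open import Data.List.Membership.Propositional using (_∈_)
open import Data.List.Membership.Propositional.Properties
  using (∈-map⁺; ∈-map⁻; ∈-++⁺ˡ; ∈-++⁺ʳ; ∈-++⁻; ∈-filter⁺; ∈-filter⁻)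
open import Data.List.Relation.Binary.Subset.Propositional using (_⊆_)
open import Data.List.Relation.Binary.Disjoint.Propositional using (Disjoint)
open import Data.List.Relation.Unary.Unique.Propositional using (Unique; []; _∷_)
import Data.List.Relation.Unary.Unique.Propositional.Properties as Uniqueₚ
open import Data.Product using (∃; _×_; _,_; proj₁; proj₂)
open import Data.Sum using (_⊎_; inj₁; inj₂)
open import Data.Empty using (⊥-elim)
open import Function using (_∘_)
open import Relation.Nullary using (yes; no)
open import Relation.Binary using (_Preserves_⟶_; tri<; tri≈; tri>)
open import Relation.Binary.PropositionalEquality

module _ {A : Set} where

  ∈-─⁺ : ∀ {x y : A} {xs} (x∈xs : x ∈ xs) → y ∈ xs → y ≢ x → y ∈ (xs ─ x∈xs)
  ∈-─⁺ (here refl)   (here refl)   y≢x = ⊥-elim (y≢x refl)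
  ∈-─⁺ (here refl)   (there y∈xs)  _   = y∈xs
  ∈-─⁺ (there _)     (here refl)   _   = here refl
  ∈-─⁺ (there x∈xs)  (there y∈xs)  y≢x = there (∈-─⁺ x∈xs y∈xs y≢x)

  Unique-⊆⇒length≤ : ∀ {xs ys : List A} → Unique xs → xs ⊆ ys → length xs ≤ length ys
  Unique-⊆⇒length≤ [] _ = z≤n
  Unique-⊆⇒length≤ {x List.∷ xs} {ys} (x∉xs ∷ xs!) xs⊆ys = begin
    suc (length xs)          ≤⟨ s≤s (Unique-⊆⇒length≤ xs! xs⊆ys─x) ⟩
    suc (length (ys ─ x∈ys)) ≡⟨ length-removeAt′ ys (index x∈ys) ⟨
    length ys                ∎
    where
    open ℕₚ.≤-Reasoning
    x∈ys : x ∈ ys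
    x∈ys = xs⊆ys (here refl)
    xs⊆ys─x : xs ⊆ (ys ─ x∈ys)
    xs⊆ys─x y∈xs = ∈-─⁺ x∈ys (xs⊆ys (there y∈xs)) (≢-sym (All.lookup x∉xs y∈xs))

length-map-++ : ∀ {A B : Set} (f : A → B) xs (ys : List B) →
                length (List.map f xs List.++ ys) ≡ length xs + length ys
length-map-++ f xs ys = trans (length-++ (List.map f xs)) (cong (_+ length ys) (length-map f xs))

m≤n+x∧k+x≤l⇒k+m≤l+n : ∀ {m n x k l} → m ≤ n + x → k + x ≤ l → k + m ≤ l + n
m≤n+x∧k+x≤l⇒k+m≤l+n {m} {n} {x} {k} {l} m≤n+x k+x≤l = begin
  k + m       ≤⟨ ℕₚ.+-monoʳ-≤ k m≤n+x ⟩
  k + (n + x) ≡⟨ x∙yz≈y∙xz k n x ⟩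
  n + (k + x) ≤⟨ ℕₚ.+-monoʳ-≤ n k+x≤l ⟩
  n + l       ≡⟨ ℕₚ.+-comm n l ⟩
  l + n       ∎
  where open ℕₚ.≤-Reasoning

module _ {m n} {f : Fin m → Fin n} (f-mono : f Preserves Fin._<_ ⟶ Fin._<_) where

  <-mono⇒≤-mono : f Preserves Fin._≤_ ⟶ Fin._≤_
  <-mono⇒≤-mono {i} {j} i≤j with i Finₚ.≟ j
  ... | yes refl = ℕₚ.≤-refl
  ... | no i≢j   = ℕₚ.<⇒≤ (f-mono (Finₚ.≤∧≢⇒< i≤j i≢j))

  <-mono⇒≤-reflecting : ∀ {i j} → f i Fin.≤ f j → i Fin.≤ j
  <-mono⇒≤-reflecting fi≤fj = ℕₚ.≮⇒≥ (λ j<i → ℕₚ.<⇒≱ (f-mono j<i) fi≤fj)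

  <-mono⇒<-reflecting : ∀ {i j} → f i Fin.< f j → i Fin.< j
  <-mono⇒<-reflecting fi<fj = ℕₚ.≰⇒> (λ j≤i → ℕₚ.<⇒≱ fi<fj (<-mono⇒≤-mono j≤i))

  <-mono⇒injective : ∀ {i j} → f i ≡ f j → i ≡ j
  <-mono⇒injective fi≡fj = Finₚ.≤-antisym
    (<-mono⇒≤-reflecting (ℕₚ.≤-reflexive (cong toℕ fi≡fj)))
    (<-mono⇒≤-reflecting (ℕₚ.≤-reflexive (cong toℕ (sym fi≡fj))))

  <-mono⇒nonzero : ∀ i → 1 ≤ toℕ i → 1 ≤ toℕ (f i)
  <-mono⇒nonzero (Fin.suc i) 0<i = ℕₚ.≤-<-trans z≤n (f-mono {Fin.zero} 0<i)

map-injective : ∀ {A B : Set} {f : A → B} → (∀ {x y} → f x ≡ f y → x ≡ y) →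
                ∀ {k} {xs ys : Vec A k} → map f xs ≡ map f ys → xs ≡ ys
map-injective f-inj {xs = []}     {[]}     _  = refl
map-injective f-inj {xs = x ∷ xs} {y ∷ ys} eq =
  cong₂ _∷_ (f-inj (∷-injectiveˡ eq)) (map-injective f-inj (∷-injectiveʳ eq))

data Split (m : ℕ) {n : ℕ} : Fin (m + n) → Set where
  prefix : (i : Fin m) → Split m (i ↑ˡ n)
  suffix : (k : Fin n) → Split m (m ↑ʳ k)

split : ∀ m {n} (j : Fin (m + n)) → Split m j
split zero    k           = suffix k
split (suc m) Fin.zero    = prefix Fin.zero
split (suc m) (Fin.suc j) with split m j
... | prefix i = prefix (Fin.suc i)
... | suffix k = suffix k

↑ˡ<↑ʳ : ∀ {m n} (i : Fin m) (k : Fin n) → i ↑ˡ n Fin.< m ↑ʳ k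
↑ˡ<↑ʳ Fin.zero    k = s≤s z≤n
↑ˡ<↑ʳ (Fin.suc i) k = s≤s (↑ˡ<↑ʳ i k)

≤↑ʳ-fromℕ : ∀ m {n} (j : Fin (m + suc n)) → j Fin.≤ m ↑ʳ fromℕ n
≤↑ʳ-fromℕ zero    j           = Finₚ.≤fromℕ j
≤↑ʳ-fromℕ (suc m) Fin.zero    = z≤n
≤↑ʳ-fromℕ (suc m) (Fin.suc j) = s≤s (≤↑ʳ-fromℕ m j)

↑ˡ-mono : ∀ {m} n → (_↑ˡ n) Preserves Fin._<_ {m} ⟶ Fin._<_
↑ˡ-mono n {i} {j} = subst₂ _<_ (sym (Finₚ.toℕ-↑ˡ i n)) (sym (Finₚ.toℕ-↑ˡ j n))

↑ʳ-mono : ∀ m {n} → (m ↑ʳ_) Preserves Fin._<_ {n} ⟶ Fin._<_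
↑ʳ-mono m {_} {i} {j} i<j =
  subst₂ _<_ (sym (Finₚ.toℕ-↑ʳ m i)) (sym (Finₚ.toℕ-↑ʳ m j)) (ℕₚ.+-monoʳ-< m i<j)

extendˡ : ∀ m {n n′} → (Fin n → Fin n′) → Fin (m + n) → Fin (m + n′)
extendˡ zero    e k           = e k
extendˡ (suc m) e Fin.zero    = Fin.zero
extendˡ (suc m) e (Fin.suc j) = Fin.suc (extendˡ m e j)

module _ {n n′} (e : Fin n → Fin n′) where

  extendˡ-↑ˡ : ∀ m (i : Fin m) → extendˡ m e (i ↑ˡ n) ≡ i ↑ˡ n′
  extendˡ-↑ˡ (suc m) Fin.zero    = refl
  extendˡ-↑ˡ (suc m) (Fin.suc i) = cong Fin.suc (extendˡ-↑ˡ m i)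

  extendˡ-↑ʳ : ∀ m (k : Fin n) → extendˡ m e (m ↑ʳ k) ≡ m ↑ʳ e k
  extendˡ-↑ʳ zero    k = refl
  extendˡ-↑ʳ (suc m) k = cong Fin.suc (extendˡ-↑ʳ m k)

  extendˡ≡↑ʳ⇒∈image : ∀ m (j : Fin (m + n)) {k} → extendˡ m e j ≡ m ↑ʳ k →
                      ∃ λ k′ → e k′ ≡ k
  extendˡ≡↑ʳ⇒∈image m j {k} eq with split m j
  ... | prefix i  = ⊥-elim (Finₚ.<⇒≢ (↑ˡ<↑ʳ i k) (trans (sym (extendˡ-↑ˡ m i)) eq))
  ... | suffix k′ = k′ , Finₚ.↑ʳ-injective m _ _ (trans (sym (extendˡ-↑ʳ m k′)) eq)

  extendˡ-mono : e Preserves Fin._<_ ⟶ Fin._<_ → ∀ m → extendˡ m e Preserves Fin._<_ ⟶ Fin._<_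
  extendˡ-mono e-mono zero    i<j = e-mono i<j
  extendˡ-mono e-mono (suc m) {Fin.zero}  {Fin.suc j} _         = s≤s z≤n
  extendˡ-mono e-mono (suc m) {Fin.suc i} {Fin.suc j} (s≤s i<j) = s≤s (extendˡ-mono e-mono m i<j)

  lookup-extendˡ : ∀ {A : Set} {m} (ws : Vec A m) {ys : Vec A n} {zs : Vec A n′} →
                   (∀ k → lookup zs (e k) ≡ lookup ys k) →
                   ∀ j → lookup (ws ++ zs) (extendˡ m e j) ≡ lookup (ws ++ ys) j
  lookup-extendˡ []       e-ok k           = e-ok k
  lookup-extendˡ (w ∷ ws) e-ok Fin.zero    = refl
  lookup-extendˡ (w ∷ ws) e-ok (Fin.suc j) = lookup-extendˡ ws e-ok j

omits-last⇒map-↑ˡ : ∀ {m k} (t : Vec (Fin (m + 1)) k) → ¬ (m ↑ʳ Fin.zero) ∈ᵥ t →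
                   ∃ λ s → map (_↑ˡ 1) s ≡ t
omits-last⇒map-↑ˡ     []      _    = [] , refl
omits-last⇒map-↑ˡ {m} (j ∷ t) j∉t with split m j | omits-last⇒map-↑ˡ t (j∉t ∘ there)
... | prefix i         | s , refl = i ∷ s , refl
... | suffix Fin.zero  | _        = ⊥-elim (j∉t (here refl))

module _ (ℝ : RealField) where
  open RealField ℝ using (Carrier; 0#)
  private module R = RealField ℝ

  +-identityʳ : ∀ x → x R.+ 0# ≡ x
  +-identityʳ x = trans (R.+-comm x 0#) (R.+-identityˡ x)

  *-zeroˡ : ∀ x → 0# R.* x ≡ 0#
  *-zeroˡ x = begin
    z                     ≡⟨ R.+-identityˡ z ⟨
    0# R.+ z              ≡⟨ cong (R._+ z) (R.-‿inverseˡ z) ⟨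
    ((R.- z) R.+ z) R.+ z ≡⟨ R.+-assoc (R.- z) z z ⟩
    (R.- z) R.+ (z R.+ z) ≡⟨ cong ((R.- z) R.+_) z≡z+z ⟨
    (R.- z) R.+ z         ≡⟨ R.-‿inverseˡ z ⟩
    0#                    ∎
    where
    open ≡-Reasoning
    z : Carrier
    z = 0# R.* x
    z≡z+z : z ≡ z R.+ z
    z≡z+z = begin
      0# R.* x                 ≡⟨ R.*-comm 0# x ⟩
      x R.* 0#                 ≡⟨ cong (x R.*_) (R.+-identityˡ 0#) ⟨
      x R.* (0# R.+ 0#)        ≡⟨ R.distribˡ x 0# 0# ⟩
      x R.* 0# R.+ x R.* 0#    ≡⟨ cong₂ R._+_ (R.*-comm x 0#) (R.*-comm x 0#) ⟩
      z R.+ z                  ∎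

  •-zeroˡ : ∀ {d} (x : Vec Carrier d) → _•_ ℝ 0# x ≡ zeroᵥ ℝ
  •-zeroˡ []       = refl
  •-zeroˡ (x ∷ xs) = cong₂ _∷_ (*-zeroˡ x) (•-zeroˡ xs)

  +ᵥ-identityˡ : ∀ {d} (x : Vec Carrier d) → _+ᵥ_ ℝ (zeroᵥ ℝ) x ≡ x
  +ᵥ-identityˡ []       = refl
  +ᵥ-identityˡ (x ∷ xs) = cong₂ _∷_ (R.+-identityˡ x) (+ᵥ-identityˡ xs)

  +ᵥ-identityʳ : ∀ {d} (x : Vec Carrier d) → _+ᵥ_ ℝ x (zeroᵥ ℝ) ≡ x
  +ᵥ-identityʳ []       = refl
  +ᵥ-identityʳ (x ∷ xs) = cong₂ _∷_ (+-identityʳ x) (+ᵥ-identityʳ xs)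

  lincomb-zero : ∀ {k d} (c : Fin k → Carrier) (f : Fin k → Vec Carrier d) →
                 (∀ a → c a ≡ 0#) → lincomb ℝ c f ≡ zeroᵥ ℝ
  lincomb-zero {zero}  c f c≡0 = refl
  lincomb-zero {suc k} c f c≡0
    rewrite c≡0 Fin.zero | •-zeroˡ (f Fin.zero)
          | lincomb-zero (c ∘ Fin.suc) (f ∘ Fin.suc) (c≡0 ∘ Fin.suc)
    = +ᵥ-identityˡ (zeroᵥ ℝ)

  lincomb-single : ∀ {k d} (c : Fin k → Carrier) (f : Fin k → Vec Carrier d) l →
                   (∀ a → a ≢ l → c a ≡ 0#) → lincomb ℝ c f ≡ _•_ ℝ (c l) (f l)
  lincomb-single {suc k} c f Fin.zero c≡0
    rewrite lincomb-zero (c ∘ Fin.suc) (f ∘ Fin.suc) (λ a → c≡0 (Fin.suc a) (λ ()))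
    = +ᵥ-identityʳ _
  lincomb-single {suc k} c f (Fin.suc l) c≡0
    rewrite c≡0 Fin.zero (λ ()) | •-zeroˡ (f Fin.zero)
    = trans (+ᵥ-identityˡ _)
            (lincomb-single (c ∘ Fin.suc) (f ∘ Fin.suc) l
              (λ a a≢l → c≡0 (Fin.suc a) (a≢l ∘ Finₚ.suc-injective)))

  lincomb-cong : ∀ {k d} (c : Fin k → Carrier) {f g : Fin k → Vec Carrier d} →
                 (∀ a → f a ≡ g a) → lincomb ℝ c f ≡ lincomb ℝ c g
  lincomb-cong {zero}  c f≗g = refl
  lincomb-cong {suc k} c f≗g =
    cong₂ (_+ᵥ_ ℝ) (cong (_•_ ℝ (c Fin.zero)) (f≗g Fin.zero))
                   (lincomb-cong (c ∘ Fin.suc) (f≗g ∘ Fin.suc))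

  InSpanFrom-at-maximum : ∀ {k d T} (ws : Vec (Vec Carrier d) T) (t : Vec (Fin T) k) l {x} →
                          (∀ a b → a Fin.< b → lookup t a Fin.< lookup t b) →
                          (∀ j → j Fin.≤ lookup t l) →
                          InSpanFrom ℝ ws t l x → SameLine ℝ x (lookup ws (lookup t l))
  InSpanFrom-at-maximum ws t l t-increasing t[l]-maximum (c , c[<l]≡0 , x≡) =
    c l , trans x≡ (lincomb-single c _ l c[≢l]≡0)
    where
    c[≢l]≡0 : ∀ a → a ≢ l → c a ≡ 0#
    c[≢l]≡0 a a≢l with Finₚ.<-cmp a l
    ... | tri< a<l _ _ = c[<l]≡0 a a<l
    ... | tri≈ _ a≡l _ = ⊥-elim (a≢l a≡l)
    ... | tri> _ _ l<a = ⊥-elim (ℕₚ.<⇒≱ (t-increasing l a l<a) (t[l]-maximum (lookup t a)))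

  record Embedding {d T T′} (ws : Vec (Vec Carrier d) T) (ws′ : Vec (Vec Carrier d) T′) : Set where
    field
      embed        : Fin T → Fin T′
      lookup-embed : ∀ i → lookup ws′ (embed i) ≡ lookup ws i
      embed-mono   : embed Preserves Fin._<_ ⟶ Fin._<_

    lookup-map-embed : ∀ {k} (t : Vec (Fin T) k) a →
                       lookup ws′ (lookup (map embed t) a) ≡ lookup ws (lookup t a)
    lookup-map-embed t a = trans (cong (lookup ws′) (lookup-map a embed t)) (lookup-embed (lookup t a))

    InSpanFrom-map⁺ : ∀ {k} (t : Vec (Fin T) k) l {x} →
                      InSpanFrom ℝ ws t l x → InSpanFrom ℝ ws′ (map embed t) l x
    InSpanFrom-map⁺ t l (c , c[<l]≡0 , x≡) =
      c , c[<l]≡0 , trans x≡ (lincomb-cong c (sym ∘ lookup-map-embed t))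

    InSpanFrom-map⁻ : ∀ {k} (t : Vec (Fin T) k) l {x} →
                      InSpanFrom ℝ ws′ (map embed t) l x → InSpanFrom ℝ ws t l x
    InSpanFrom-map⁻ t l (c , c[<l]≡0 , x≡) =
      c , c[<l]≡0 , trans x≡ (lincomb-cong c (lookup-map-embed t))

    LinIndep-map⁺ : ∀ {k} (t : Vec (Fin T) k) → LinIndep ℝ (λ a → lookup ws (lookup t a)) →
                    LinIndep ℝ (λ a → lookup ws′ (lookup (map embed t) a))
    LinIndep-map⁺ t indep c ≡0 = indep c (trans (lincomb-cong c (sym ∘ lookup-map-embed t)) ≡0)

    LinIndep-map⁻ : ∀ {k} (t : Vec (Fin T) k) →
                    LinIndep ℝ (λ a → lookup ws′ (lookup (map embed t) a)) →
                    LinIndep ℝ (λ a → lookup ws (lookup t a))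
    LinIndep-map⁻ t indep c ≡0 = indep c (trans (lincomb-cong c (lookup-map-embed t)) ≡0)

  module _ {n T T′} {ws : Vec (Vec Carrier (suc n)) T} {ws′ : Vec (Vec Carrier (suc n)) T′}
           (e : Embedding ws ws′) where
    open Embedding e

    InB-map⁺ : ∀ t → InB ℝ ws t →
               (∀ l j′ → InSpanFrom ℝ ws′ (map embed t) l (lookup ws′ j′) →
                         (∃ λ j → embed j ≡ j′) ⊎ embed (lookup t l) Fin.≤ j′) →
               InB ℝ ws′ (map embed t)
    InB-map⁺ t (nonzero , increasing , minimal , indep) new-points-later =
      (λ a → subst (λ i → 1 ≤ toℕ i) (sym (lookup-map a embed t))
               (<-mono⇒nonzero embed-mono _ (nonzero a))) ,
      (λ a b a<b → subst₂ Fin._<_ (sym (lookup-map a embed t)) (sym (lookup-map b embed t))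
                     (embed-mono (increasing a b a<b))) ,
      (λ l j′ span → subst (Fin._≤ j′) (sym (lookup-map l embed t))
                       (embed-minimal l j′ span (new-points-later l j′ span))) ,
      LinIndep-map⁺ t indep
      where
      embed-minimal : ∀ l j′ → InSpanFrom ℝ ws′ (map embed t) l (lookup ws′ j′) →
                      (∃ λ j → embed j ≡ j′) ⊎ embed (lookup t l) Fin.≤ j′ →
                      embed (lookup t l) Fin.≤ j′
      embed-minimal l _ span (inj₁ (j , refl)) = <-mono⇒≤-mono embed-mono
        (minimal l j (subst (InSpanFrom ℝ ws t l) (lookup-embed j) (InSpanFrom-map⁻ t l span)))
      embed-minimal l j′ span (inj₂ t[l]≤j′) = t[l]≤j′

    InB-map⁻ : (∀ i → 1 ≤ toℕ (embed i) → 1 ≤ toℕ i) →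
               ∀ t → InB ℝ ws′ (map embed t) → InB ℝ ws t
    InB-map⁻ embed-reflects-nonzero t (nonzero , increasing , minimal , indep) =
      (λ a → embed-reflects-nonzero _ (subst (λ i → 1 ≤ toℕ i) (lookup-map a embed t) (nonzero a))) ,
      (λ a b a<b → <-mono⇒<-reflecting embed-mono
                     (subst₂ Fin._<_ (lookup-map a embed t) (lookup-map b embed t) (increasing a b a<b))) ,
      (λ l j span → <-mono⇒≤-reflecting embed-mono (subst (Fin._≤ embed j) (lookup-map l embed t)
        (minimal l (embed j) (subst (InSpanFrom ℝ ws′ (map embed t) l) (sym (lookup-embed j))
                                    (InSpanFrom-map⁺ t l span))))) ,
      LinIndep-map⁻ t indep

  prefix-embedding : ∀ {d T m} (ws : Vec (Vec Carrier d) T) (ys : Vec (Vec Carrier d) m) →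
                     Embedding ws (ws ++ ys)
  prefix-embedding {m = m} ws ys = record
    { embed = _↑ˡ m ; lookup-embed = lookup-++ˡ ws ys ; embed-mono = ↑ˡ-mono m }

  suffix-embedding : ∀ {d T m} (xs : Vec (Vec Carrier d) T) (ws : Vec (Vec Carrier d) m) →
                     Embedding ws (xs ++ ws)
  suffix-embedding {T = T} xs ws = record
    { embed = T ↑ʳ_ ; lookup-embed = lookup-++ʳ xs ws ; embed-mono = ↑ʳ-mono T }

  prepend-embedding : ∀ {d T m m′} (ws : Vec (Vec Carrier d) T)
                      {ys : Vec (Vec Carrier d) m} {zs : Vec (Vec Carrier d) m′} →
                      Embedding ys zs → Embedding (ws ++ ys) (ws ++ zs)
  prepend-embedding {T = T} ws e = record
    { embed        = extendˡ T embed
    ; lookup-embed = lookup-extendˡ embed ws lookup-embed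
    ; embed-mono   = extendˡ-mono embed embed-mono T
    }
    where open Embedding e

  IsEtaStar⇒≤length : ∀ {n T} (ws : Vec (Vec Carrier (suc n)) T) {k L} → IsEtaStar ℝ n ws k →
                      (∀ {t} → InB ℝ ws t → t ∈ L) → k ≤ length L
  IsEtaStar⇒≤length _ (B , B! , B⇔ , |B|≡k) covers =
    subst (_≤ _) |B|≡k (Unique-⊆⇒length≤ B! (λ {t} t∈B → covers (proj₁ (B⇔ t) t∈B)))

  IsEtaStar⇒length≤ : ∀ {n T} (ws : Vec (Vec Carrier (suc n)) T) {k L} → IsEtaStar ℝ n ws k →
                      Unique L → (∀ {t} → t ∈ L → InB ℝ ws t) → length L ≤ k
  IsEtaStar⇒length≤ _ (B , _ , B⇔ , |B|≡k) L! L⊆B =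
    subst (_ ≤_) |B|≡k (Unique-⊆⇒length≤ L! (λ {t} t∈L → proj₂ (B⇔ t) (L⊆B t∈L)))

  module Supermodularity {n T} (ws : Vec (Vec Carrier (suc n)) T) (u v : Vec Carrier (suc n))
                         (u≁v : ¬ SameLine ℝ u v) where
    open import Data.Vec.Membership.DecPropositional (Finₚ._≟_ {T + 1}) using (_∈?_)

    wsᵘ wsᵛ : Vec (Vec Carrier (suc n)) (T + 1)
    wsᵘ = ws ++ u ∷ []
    wsᵛ = ws ++ v ∷ []

    ws² : Vec (Vec Carrier (suc n)) (T + 2)
    ws² = ws ++ u ∷ v ∷ []

    ws↪wsᵛ : Embedding ws wsᵛ
    ws↪wsᵛ = prefix-embedding ws (v ∷ [])

    wsᵘ↪ws² : Embedding wsᵘ ws²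
    wsᵘ↪ws² = prepend-embedding ws (prefix-embedding (u ∷ []) (v ∷ []))

    wsᵛ↪ws² : Embedding wsᵛ ws²
    wsᵛ↪ws² = prepend-embedding ws (suffix-embedding (u ∷ []) (v ∷ []))

    ιᵘ ιᵛ : Fin (T + 1) → Fin (T + 2)
    ιᵘ = Embedding.embed wsᵘ↪ws²
    ιᵛ = Embedding.embed wsᵛ↪ws²

    v-position : Fin (T + 1)
    v-position = T ↑ʳ Fin.zero

    InB-wsᵛ-omitting-v : ∀ t → InB ℝ wsᵛ t → ¬ v-position ∈ᵥ t →
                         ∃ λ s → map (_↑ˡ 1) s ≡ t × InB ℝ ws s
    InB-wsᵛ-omitting-v t inB t∌v with omits-last⇒map-↑ˡ t t∌v
    ... | s , refl = s , refl , InB-map⁻ ws↪wsᵛ (λ i → subst (1 ≤_) (Finₚ.toℕ-↑ˡ i 1)) s inB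

    InB-wsᵘ⇒InB-ws² : ∀ s → InB ℝ wsᵘ s → InB ℝ ws² (map ιᵘ s)
    InB-wsᵘ⇒InB-ws² s inB = InB-map⁺ wsᵘ↪ws² s inB new-points-later
      where
      new-points-later : ∀ l j′ → InSpanFrom ℝ ws² (map ιᵘ s) l (lookup ws² j′) →
                         (∃ λ j → ιᵘ j ≡ j′) ⊎ ιᵘ (lookup s l) Fin.≤ j′
      new-points-later l j′ _ with split T j′
      ... | prefix i                  = inj₁ (i ↑ˡ 1 , extendˡ-↑ˡ (_↑ˡ 1) T i)
      ... | suffix Fin.zero           = inj₁ (T ↑ʳ Fin.zero , extendˡ-↑ʳ (_↑ˡ 1) T Fin.zero)
      ... | suffix (Fin.suc Fin.zero) = inj₂ (≤↑ʳ-fromℕ T _)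

    u∉span-from-v : ∀ s l → InB ℝ wsᵛ s → lookup s l ≡ v-position →
                    ¬ InSpanFrom ℝ ws² (map ιᵛ s) l u
    u∉span-from-v s l (_ , increasing , _ , _) s[l]≡v span with
      InSpanFrom-at-maximum wsᵛ s l increasing (λ j → subst (j Fin.≤_) (sym s[l]≡v) (≤↑ʳ-fromℕ T j))
                            (Embedding.InSpanFrom-map⁻ wsᵛ↪ws² s l span)
    ... | c , u≡cw = u≁v (c , trans u≡cw (cong (_•_ ℝ c) w≡v))
      where
      w≡v : lookup wsᵛ (lookup s l) ≡ v
      w≡v = trans (cong (lookup wsᵛ) s[l]≡v) (lookup-++ʳ ws (v ∷ []) Fin.zero)

    ιᵛ-below-u : ∀ j → j ≢ v-position → ιᵛ j Fin.≤ T ↑ʳ Fin.zero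
    ιᵛ-below-u j j≢v with split T j
    ... | prefix i        =
      subst (Fin._≤ T ↑ʳ Fin.zero) (sym (extendˡ-↑ˡ (1 ↑ʳ_) T i)) (ℕₚ.<⇒≤ (↑ˡ<↑ʳ i Fin.zero))
    ... | suffix Fin.zero = ⊥-elim (j≢v refl)

    InB-wsᵛ⇒InB-ws² : ∀ s → InB ℝ wsᵛ s → InB ℝ ws² (map ιᵛ s)
    InB-wsᵛ⇒InB-ws² s inB = InB-map⁺ wsᵛ↪ws² s inB new-points-later
      where
      new-points-later : ∀ l j′ → InSpanFrom ℝ ws² (map ιᵛ s) l (lookup ws² j′) →
                         (∃ λ j → ιᵛ j ≡ j′) ⊎ ιᵛ (lookup s l) Fin.≤ j′
      new-points-later l j′ span with split T j′
      ... | prefix i                  = inj₁ (i ↑ˡ 1 , extendˡ-↑ˡ (1 ↑ʳ_) T i)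
      ... | suffix (Fin.suc Fin.zero) = inj₁ (T ↑ʳ Fin.zero , extendˡ-↑ʳ (1 ↑ʳ_) T Fin.zero)
      ... | suffix Fin.zero with lookup s l Finₚ.≟ v-position
      ...   | yes s[l]≡v = ⊥-elim (u∉span-from-v s l inB s[l]≡v
                       (subst (InSpanFrom ℝ ws² (map ιᵛ s) l) ws²[T]≡u span))
        where
        ws²[T]≡u : lookup ws² (T ↑ʳ Fin.zero) ≡ u
        ws²[T]≡u = lookup-++ʳ ws (u ∷ v ∷ []) Fin.zero
      ...   | no s[l]≢v  = inj₂ (ιᵛ-below-u (lookup s l) s[l]≢v)

    ιᵘ-images-avoid-ιᵛ[v] : ∀ {k} (s s′ : Vec (Fin (T + 1)) k) → v-position ∈ᵥ s′ →
                            map ιᵘ s ≢ map ιᵛ s′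
    ιᵘ-images-avoid-ιᵛ[v] s s′ s′∋v ιᵘs≡ιᵛs′
      with satisfied (VecAnyₚ.map⁻ (subst (ιᵛ v-position ∈ᵥ_) (sym ιᵘs≡ιᵛs′)
                                         (∈ᵥ-map⁺ ιᵛ s′∋v)))
    ... | j , ιᵛ[v]≡ιᵘj with extendˡ≡↑ʳ⇒∈image (_↑ˡ 1) T j
                               (trans (sym ιᵛ[v]≡ιᵘj) (extendˡ-↑ʳ (1 ↑ʳ_) T Fin.zero))
    ... | Fin.zero , ()

    tuples-using-v : ∀ {c} → IsEtaStar ℝ n wsᵛ c → List (Vec (Fin (T + 1)) n)
    tuples-using-v (C , _) = filter (v-position ∈?_) C

    wsᵛ-bound : ∀ {a c} → IsEtaStar ℝ n ws a → (ηc : IsEtaStar ℝ n wsᵛ c) →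
                c ≤ a + length (tuples-using-v ηc)
    wsᵛ-bound (A , _ , A⇔ , |A|≡a) ηc@(C , _ , C⇔ , _) =
      subst (_ ≤_) (trans (length-map-++ (map (_↑ˡ 1)) A _) (cong (_+ _) |A|≡a))
        (IsEtaStar⇒≤length wsᵛ ηc covers)
      where
      covers : ∀ {t} → InB ℝ wsᵛ t → t ∈ List.map (map (_↑ˡ 1)) A List.++ tuples-using-v ηc
      covers {t} inB with v-position ∈? t
      ... | yes t∋v = ∈-++⁺ʳ _ (∈-filter⁺ _ (proj₂ (C⇔ t) inB) t∋v)
      ... | no t∌v with InB-wsᵛ-omitting-v t inB t∌v
      ...   | s , refl , inB-s = ∈-++⁺ˡ (∈-map⁺ (map (_↑ˡ 1)) (proj₂ (A⇔ s) inB-s))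

    ws²-bound : ∀ {b c d} → IsEtaStar ℝ n wsᵘ b → (ηc : IsEtaStar ℝ n wsᵛ c) →
                IsEtaStar ℝ n ws² d →
                b + length (tuples-using-v ηc) ≤ d
    ws²-bound (B , B! , B⇔ , |B|≡b) ηc@(C , C! , C⇔ , _) ηd =
      subst (_≤ _) (trans (length-map-++ (map ιᵘ) B _)
                          (cong₂ _+_ |B|≡b (length-map (map ιᵛ) (tuples-using-v ηc))))
        (IsEtaStar⇒length≤ ws² ηd images! images⊆B²)
      where
      images : List (Vec (Fin (T + 2)) n)
      images = List.map (map ιᵘ) B List.++ List.map (map ιᵛ) (tuples-using-v ηc)

      disjoint : Disjoint (List.map (map ιᵘ) B) (List.map (map ιᵛ) (tuples-using-v ηc))
      disjoint (t∈ιᵘB , t∈ιᵛX) with ∈-map⁻ (map ιᵘ) t∈ιᵘB | ∈-map⁻ (map ιᵛ) t∈ιᵛX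
      ... | s , _ , refl | s′ , s′∈X , ιᵘs≡ιᵛs′ =
        ιᵘ-images-avoid-ιᵛ[v] s s′ (proj₂ (∈-filter⁻ _ {xs = C} s′∈X)) ιᵘs≡ιᵛs′

      images! : Unique images
      images! = Uniqueₚ.++⁺
        (Uniqueₚ.map⁺ (map-injective (<-mono⇒injective (Embedding.embed-mono wsᵘ↪ws²))) B!)
        (Uniqueₚ.map⁺ (map-injective (<-mono⇒injective (Embedding.embed-mono wsᵛ↪ws²)))
                      (Uniqueₚ.filter⁺ _ C!))
        disjoint

      images⊆B² : ∀ {t} → t ∈ images → InB ℝ ws² t
      images⊆B² t∈ with ∈-++⁻ (List.map (map ιᵘ) B) t∈
      ... | inj₁ t∈ιᵘB with ∈-map⁻ (map ιᵘ) t∈ιᵘB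
      ...   | s , s∈B , refl = InB-wsᵘ⇒InB-ws² s (proj₁ (B⇔ s) s∈B)
      images⊆B² t∈ | inj₂ t∈ιᵛX with ∈-map⁻ (map ιᵛ) t∈ιᵛX
      ...   | s , s∈X , refl =
        InB-wsᵛ⇒InB-ws² s (proj₁ (C⇔ s) (proj₁ (∈-filter⁻ _ {xs = C} s∈X)))

proposition1 : (ℝ : RealField) → (n : ℕ) → 1 ≤ n →
    ∀ {T} (ws : Vec (Vec (RealField.Carrier ℝ) (suc n)) T) → DistinctPoints ℝ ws →
    (u v : Vec (RealField.Carrier ℝ) (suc n)) →
    NonZeroV ℝ u → NonZeroV ℝ v → ¬ SameLine ℝ u v →
    NotInPoints ℝ u ws → NotInPoints ℝ v ws →
    (a b c d : ℕ) →
    IsEtaStar ℝ n ws a → IsEtaStar ℝ n (ws ++ u ∷ []) b →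
    IsEtaStar ℝ n (ws ++ v ∷ []) c → IsEtaStar ℝ n (ws ++ u ∷ v ∷ []) d →
    b + c ≤ d + a
proposition1 ℝ n _ ws _ u v _ _ u≁v _ _ a b c d ηa ηb ηc ηd =
  m≤n+x∧k+x≤l⇒k+m≤l+n (wsᵛ-bound ηa ηc) (ws²-bound ηb ηc ηd)
  where open Supermodularity ℝ ws u v u≁v
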